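{- For every integer $x$, there exists a nonempty finite set $A_x \subseteq \mathbb{Z}$ such that $\Delta(A_x) = -x$, i.e. $|A_x \dotplus A_x| - |A_x - A_x| = x$.
   Context: For a nonempty finite set $A \subseteq \mathbb{Z}$, define $A - A := \{a - b : a, b \in A\}$, the restricted sumset $A \dotplus A := \{a + b : a, b \in A,\ a \neq b\}$, and $\Delta(A) := |A - A| - |A \dotplus A|$. -}

module Defs where

open import Data.Integer using (ℤ; _+_; _-_)
open import Data.Integer.Properties using (_≟_)
open import Data.Nat using (ℕ)
open import Data.List using (List; length; deduplicate; cartesianProduct; filter; map)
open import Data.Product using (_×_; _,_; proj₁; proj₂)
open import Relation.Nullary using (¬?)

-- A finite set of integers is represented by a list (duplicates irrelevant);
-- its cardinality is the length of the deduplicated list.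
card : List ℤ → ℕ
card xs = length (deduplicate _≟_ xs)

diffSet : List ℤ → List ℤ
diffSet A = map (λ p → proj₁ p - proj₂ p) (cartesianProduct A A)

restrSumSet : List ℤ → List ℤ
restrSumSet A =
  map (λ p → proj₁ p + proj₂ p)
      (filter (λ p → ¬? (proj₁ p ≟ proj₂ p)) (cartesianProduct A A))

Δ : List ℤ → ℤ
Δ A = card (diffSet A) ⊖ card (restrSumSet A)
  where open import Data.Integer using (_⊖_)

module Submission where

-- Spread k translated copies of a small base set B far apart:
--   block B k = ⋃_{i<k} (2w·i + B).
-- If the elements, differences and sums of B are digits, i.e. of absolute value
-- below w, then an integer has at most one expansion 2w·e + d with a digit d,
-- so A - A and A ∔ A of A = block B k split into disjoint translated layers:
--   A - A = ⋃_{|e| < k} (2w·e + (B - B)),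
--   A ∔ A = (B ∔ B) ∪ (2w·(2k-2) + B ∔ B) ∪ ⋃_{0 < e < 2k-2} (2w·e + (B + B)).
-- Counting layers gives, for k ≥ 2,
--   Δ(block B k) = (2k-1)|B - B| - 2|B ∔ B| - (2k-3)|B + B|,
-- an arithmetic progression in k of step 2(|B - B| - |B + B|).  Six base sets
-- (steps ±2 and ±4) and two sporadic sets realise every integer; which one is
-- used is decided by the residue of the target modulo 4.

open import Defs
open import Data.Integer using (ℤ; -_)
open import Data.List using (List; [])
open import Data.Product using (Σ; _×_)
open import Relation.Binary.PropositionalEquality using (_≡_; _≢_)

open import Data.Integer using (+_; -[1+_]; _+_; _-_; _*_; ∣_∣; _⊖_)
import Data.Integer.Properties as ℤ
open import Data.Integer.Tactic.RingSolver using (solve-∀)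
open import Data.Nat as ℕ using (ℕ; zero; suc; _<_; _≤_; s≤s; z≤n)
import Data.Nat.Properties as ℕ
import Data.Nat.Tactic.RingSolver as ℕ-Solver
open import Data.Nat.DivMod using (_%_; _/_; m≡m%n+[m/n]*n; m%n<n)
open import Data.List using (_∷_; _++_; map; length; upTo; deduplicate; cartesianProduct)
import Data.List.Properties as List
open import Data.List.Membership.Propositional using (_∈_)
open import Data.List.Membership.Propositional.Properties
open import Data.List.Membership.Propositional.Properties.WithK using (unique∧set⇒bag)
open import Data.List.Relation.Binary.Subset.Propositional using (_⊆_)
open import Data.List.Relation.Binary.BagAndSetEquality using (∼bag⇒↭)
open import Data.List.Relation.Binary.Permutation.Propositional.Properties using (↭-length)
open import Data.List.Relation.Unary.Any using (here; there)
open import Data.List.Relation.Unary.All as All using (All)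
import Data.List.Relation.Unary.All.Properties as All
open import Data.List.Relation.Unary.AllPairs using ([]; _∷_)
open import Data.List.Relation.Unary.Unique.Propositional using (Unique)
import Data.List.Relation.Unary.Unique.Propositional.Properties as Unique
open import Data.List.Relation.Unary.Unique.DecPropositional.Properties ℤ._≟_ using (deduplicate-!)
open import Algebra.Properties.AbelianGroup ℤ.+-0-abelianGroup using (∙-cancelˡ)
open import Data.Product using (_,_; proj₁; proj₂; ∃; ∃₂)
open import Data.Sum using (inj₁; inj₂)
open import Function using (_∘_; mk⇔; Equivalence)
open import Relation.Nullary using (¬_; Dec; yes; no; ¬?; contradiction)
open import Relation.Nullary.Decidable using (True; toWitness)
open import Relation.Binary.PropositionalEquality using (refl; sym; trans; cong; cong₂; subst; module ≡-Reasoning)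

∈-dedup⁺ : ∀ {z xs} → z ∈ xs → z ∈ deduplicate ℤ._≟_ xs
∈-dedup⁺ = Equivalence.to (deduplicate-∈⇔ ℤ._≟_)

∈-dedup⁻ : ∀ {z xs} → z ∈ deduplicate ℤ._≟_ xs → z ∈ xs
∈-dedup⁻ = Equivalence.from (deduplicate-∈⇔ ℤ._≟_)

card-≡ : ∀ {xs u} → Unique u → xs ⊆ u → u ⊆ xs → card xs ≡ length u
card-≡ {xs} u! xs⊆u u⊆xs =
  ↭-length (∼bag⇒↭ (unique∧set⇒bag (deduplicate-! xs) u!
    (mk⇔ (xs⊆u ∘ ∈-dedup⁻) (∈-dedup⁺ ∘ u⊆xs))))

pairSum : ℤ × ℤ → ℤ
pairSum p = proj₁ p + proj₂ p

pairDiff : ℤ × ℤ → ℤ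
pairDiff p = proj₁ p - proj₂ p

distinct? : (p : ℤ × ℤ) → Dec (proj₁ p ≢ proj₂ p)
distinct? p = ¬? (proj₁ p ℤ.≟ proj₂ p)

sumSet : List ℤ → List ℤ
sumSet A = map pairSum (cartesianProduct A A)

∈-diffSet⁺ : ∀ {A a a'} → a ∈ A → a' ∈ A → a - a' ∈ diffSet A
∈-diffSet⁺ a∈ a'∈ = ∈-map⁺ pairDiff (∈-cartesianProduct⁺ a∈ a'∈)

∈-diffSet⁻ : ∀ A {z} → z ∈ diffSet A → ∃₂ λ a a' → a ∈ A × a' ∈ A × z ≡ a - a'
∈-diffSet⁻ A z∈ with ∈-map⁻ pairDiff z∈
... | (a , a') , p∈ , refl with ∈-cartesianProduct⁻ A A p∈
...   | a∈ , a'∈ = a , a' , a∈ , a'∈ , refl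

∈-sumSet⁺ : ∀ {A a a'} → a ∈ A → a' ∈ A → a + a' ∈ sumSet A
∈-sumSet⁺ a∈ a'∈ = ∈-map⁺ pairSum (∈-cartesianProduct⁺ a∈ a'∈)

∈-sumSet⁻ : ∀ A {z} → z ∈ sumSet A → ∃₂ λ a a' → a ∈ A × a' ∈ A × z ≡ a + a'
∈-sumSet⁻ A z∈ with ∈-map⁻ pairSum z∈
... | (a , a') , p∈ , refl with ∈-cartesianProduct⁻ A A p∈
...   | a∈ , a'∈ = a , a' , a∈ , a'∈ , refl

∈-restrSumSet⁺ : ∀ {A a a'} → a ∈ A → a' ∈ A → a ≢ a' → a + a' ∈ restrSumSet A
∈-restrSumSet⁺ a∈ a'∈ a≢a' = ∈-map⁺ pairSum (∈-filter⁺ distinct? (∈-cartesianProduct⁺ a∈ a'∈) a≢a')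

∈-restrSumSet⁻ : ∀ A {z} → z ∈ restrSumSet A → ∃₂ λ a a' → a ∈ A × a' ∈ A × a ≢ a' × z ≡ a + a'
∈-restrSumSet⁻ A z∈ with ∈-map⁻ pairSum z∈
... | (a , a') , p∈ , refl with ∈-filter⁻ distinct? p∈
...   | q∈ , a≢a' with ∈-cartesianProduct⁻ A A q∈
...     | a∈ , a'∈ = a , a' , a∈ , a'∈ , a≢a' , refl

differences sums restrictedSums : List ℤ → List ℤ
differences B = deduplicate ℤ._≟_ (diffSet B)
sums B = deduplicate ℤ._≟_ (sumSet B)
restrictedSums B = deduplicate ℤ._≟_ (restrSumSet B)

translate-difference : ∀ x e e' b b' → (x * e + b) - (x * e' + b') ≡ x * (e - e') + (b - b')
translate-difference = solve-∀

translate-sum : ∀ x e e' b b' → (x * e + b) + (x * e' + b') ≡ x * (e + e') + (b + b')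
translate-sum = solve-∀

scaled-difference : ∀ x e e' d d' → x * e + d ≡ x * e' + d' → x * (e - e') ≡ d' - d
scaled-difference x e e' d d' eq = begin
  x * (e - e')                ≡⟨ expand x e e' d ⟩
  (x * e + d) - (x * e' + d)  ≡⟨ cong (_- (x * e' + d)) eq ⟩
  (x * e' + d') - (x * e' + d) ≡⟨ cancel (x * e') d d' ⟩
  d' - d                      ∎
  where
  open ≡-Reasoning
  expand : ∀ x e e' d → x * (e - e') ≡ (x * e + d) - (x * e' + d)
  expand = solve-∀
  cancel : ∀ y d d' → (y + d') - (y + d) ≡ d' - d
  cancel = solve-∀

m*n<m⇒n≡0 : ∀ m n → m ℕ.* n < m → n ≡ 0
m*n<m⇒n≡0 m zero    _  = refl
m*n<m⇒n≡0 m (suc n) lt = contradiction lt (ℕ.≤⇒≯ (ℕ.m≤m*n m (suc n)))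

⊖-cross : ∀ {a b} c d → a ℕ.+ d ≡ b ℕ.+ c → a ⊖ b ≡ c ⊖ d
⊖-cross {a} {b} c d eq = begin
  a ⊖ b                  ≡⟨ ℤ.+-cancelˡ-⊖ d a b ⟨
  (d ℕ.+ a) ⊖ (d ℕ.+ b)  ≡⟨ cong₂ _⊖_ (trans (ℕ.+-comm d a) eq) (ℕ.+-comm d b) ⟩
  (b ℕ.+ c) ⊖ (b ℕ.+ d)  ≡⟨ ℤ.+-cancelˡ-⊖ b c d ⟩
  c ⊖ d                  ∎
  where open ≡-Reasoning

Realisable : ℤ → Set
Realisable t = Σ (List ℤ) λ A → (A ≢ []) × (Δ A ≡ t)

-- Layers, parametrised by the digit bound w

module Layering (w : ℕ) where

  Digit : ℤ → Set
  Digit d = ∣ d ∣ < w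

  base : ℤ
  base = + (w ℕ.+ w)

  place : ℤ → ℤ → ℤ
  place e d = base * e + d

  -- An integer has at most one expansion base * e + d with a digit d.
  -- This is what keeps the translated layers below disjoint.
  expansion-unique : ∀ {e e' d d'} → Digit d → Digit d' → place e d ≡ place e' d' → e ≡ e'
  expansion-unique {e} {e'} {d} {d'} d-digit d'-digit eq =
    ℤ.i-j≡0⇒i≡j e e' (ℤ.∣i∣≡0⇒i≡0 (m*n<m⇒n≡0 (w ℕ.+ w) ∣ e - e' ∣ small))
    where
    open ℕ.≤-Reasoning
    small : (w ℕ.+ w) ℕ.* ∣ e - e' ∣ < w ℕ.+ w
    small = begin-strict
      (w ℕ.+ w) ℕ.* ∣ e - e' ∣     ≡⟨ ℤ.abs-* base (e - e') ⟨
      ∣ base * (e - e') ∣         ≡⟨ cong ∣_∣ (scaled-difference base e e' d d' eq) ⟩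
      ∣ d' - d ∣                  ≤⟨ ℤ.∣i-j∣≤∣i∣+∣j∣ d' d ⟩
      ∣ d' ∣ ℕ.+ ∣ d ∣            <⟨ ℕ.+-mono-< d'-digit d-digit ⟩
      w ℕ.+ w                     ∎

  -- A layer (e , L) stands for the translate base * e + L.
  Layer : Set
  Layer = ℤ × List ℤ

  layers : List Layer → List ℤ
  layers []             = []
  layers ((e , L) ∷ ps) = map (place e) L ++ layers ps

  ∈-layers⁺ : ∀ ps {e L d} → (e , L) ∈ ps → d ∈ L → place e d ∈ layers ps
  ∈-layers⁺ ((e , L) ∷ ps) (here refl) d∈ = ∈-++⁺ˡ (∈-map⁺ (place e) d∈)
  ∈-layers⁺ ((e , L) ∷ ps) (there p∈)  d∈ = ∈-++⁺ʳ (map (place e) L) (∈-layers⁺ ps p∈ d∈)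

  ∈-layers⁻ : ∀ ps {z} → z ∈ layers ps → ∃₂ λ e L → (e , L) ∈ ps × ∃ λ d → d ∈ L × z ≡ place e d
  ∈-layers⁻ ((e , L) ∷ ps) z∈ with ∈-++⁻ (map (place e) L) z∈
  ... | inj₁ z∈L with ∈-map⁻ (place e) z∈L
  ...   | d , d∈ , z≡ = e , L , here refl , d , d∈ , z≡
  ∈-layers⁻ ((e , L) ∷ ps) z∈ | inj₂ z∈ps with ∈-layers⁻ ps z∈ps
  ... | e' , L' , p∈ , d , d∈ , z≡ = e' , L' , there p∈ , d , d∈ , z≡

  ProperLayer : Layer → Set
  ProperLayer (e , L) = Unique L × All Digit L

  -- Proper layers with distinct indices have disjoint translates, so their union
  -- is duplicate-free.
  layers-unique : ∀ ps → Unique (map proj₁ ps) → All ProperLayer ps → Unique (layers ps)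
  layers-unique []             _            _                        = []
  layers-unique ((e , L) ∷ ps) (e∉ ∷ ps!) ((L! , L-digits) All.∷ ps-proper) =
    Unique.++⁺ (Unique.map⁺ (∙-cancelˡ (base * e) _ _) L!) (layers-unique ps ps! ps-proper) disjoint
    where
    disjoint : ∀ {z} → ¬ (z ∈ map (place e) L × z ∈ layers ps)
    disjoint (z∈L , z∈ps) with ∈-map⁻ (place e) z∈L | ∈-layers⁻ ps z∈ps
    ... | d , d∈ , refl | e' , L' , p∈ , d' , d'∈ , same =
      All.lookup e∉ (∈-map⁺ proj₁ p∈)
        (expansion-unique (All.lookup L-digits d∈) (All.lookup (proj₂ (All.lookup ps-proper p∈)) d'∈) same)

  length-layers-∷ : ∀ e L ps → length (layers ((e , L) ∷ ps)) ≡ length L ℕ.+ length (layers ps)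
  length-layers-∷ e L ps = trans (List.length-++ (map (place e) L)) (cong (ℕ._+ _) (List.length-map (place e) L))

  copies : List ℤ → List ℤ → List Layer
  copies es L = map (_, L) es

  copies-indices : ∀ es L → map proj₁ (copies es L) ≡ es
  copies-indices []       L = refl
  copies-indices (e ∷ es) L = cong (e ∷_) (copies-indices es L)

  copies-proper : ∀ es {L} → Unique L → All Digit L → All ProperLayer (copies es L)
  copies-proper es L! L-digits = All.map⁺ (All.universal (λ _ → L! , L-digits) es)

  ∈-copies⁻ : ∀ es L {e L'} → (e , L') ∈ copies es L → e ∈ es × L' ≡ L
  ∈-copies⁻ es L p∈ with ∈-map⁻ (_, L) p∈
  ... | e , e∈ , refl = e∈ , refl

  length-copies : ∀ es L → length (layers (copies es L)) ≡ length es ℕ.* length L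
  length-copies []       L = refl
  length-copies (e ∷ es) L = trans (length-layers-∷ e L (copies es L)) (cong (length L ℕ.+_) (length-copies es L))

  block : List ℤ → ℕ → List ℤ
  block B k = layers (copies (map +_ (upTo k)) B)

  ∈-block⁺ : ∀ B {k i b} → i < k → b ∈ B → place (+ i) b ∈ block B k
  ∈-block⁺ B {k} i<k b∈ =
    ∈-layers⁺ (copies (map +_ (upTo k)) B) (∈-map⁺ (_, B) (∈-map⁺ +_ (∈-upTo⁺ i<k))) b∈

  ∈-block⁻ : ∀ B k {a} → a ∈ block B k → ∃ λ i → i < k × ∃ λ b → b ∈ B × a ≡ place (+ i) b
  ∈-block⁻ B k a∈ with ∈-layers⁻ (copies (map +_ (upTo k)) B) a∈
  ... | e , L , p∈ , b , b∈ , a≡ with ∈-copies⁻ (map +_ (upTo k)) B p∈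
  ...   | e∈ , refl with ∈-map⁻ +_ e∈
  ...     | i , i∈ , refl = i , ∈-upTo⁻ i∈ , b , b∈ , a≡

  -- The difference set of a block.  Index differences of suc k copies form
  -- offsets k = {-k, …, k}; each carries a full copy of B - B.

  offsets : ℕ → List ℤ
  offsets k = map +_ (upTo (suc k)) ++ map -[1+_] (upTo k)

  offsets-unique : ∀ k → Unique (offsets k)
  offsets-unique k =
    Unique.++⁺ (Unique.map⁺ ℤ.+-injective (Unique.upTo⁺ (suc k)))
               (Unique.map⁺ ℤ.-[1+-injective (Unique.upTo⁺ k)) signs-differ
    where
    signs-differ : ∀ {o} → ¬ (o ∈ map +_ (upTo (suc k)) × o ∈ map -[1+_] (upTo k))
    signs-differ (o∈⁺ , o∈⁻) with ∈-map⁻ +_ o∈⁺ | ∈-map⁻ -[1+_] o∈⁻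
    ... | _ , _ , refl | _ , _ , ()

  length-offsets : ∀ k → length (offsets k) ≡ suc k ℕ.+ k
  length-offsets k =
    trans (List.length-++ (map +_ (upTo (suc k)))) (cong₂ ℕ._+_ (count +_ (suc k)) (count -[1+_] k))
    where
    count : ∀ (f : ℕ → ℤ) n → length (map f (upTo n)) ≡ n
    count f n = trans (List.length-map f (upTo n)) (List.length-upTo n)

  ∈-offsets⁺ : ∀ {k} i i' → i ≤ k → i' ≤ k → i ⊖ i' ∈ offsets k
  ∈-offsets⁺ i       zero     i≤k  _     = ∈-++⁺ˡ (∈-map⁺ +_ (∈-upTo⁺ (s≤s i≤k)))
  ∈-offsets⁺ zero    (suc i') _    i'<k  = ∈-++⁺ʳ (map +_ (upTo _)) (∈-map⁺ -[1+_] (∈-upTo⁺ i'<k))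
  ∈-offsets⁺ {k} (suc i) (suc i') i<k  i'<k  =
    subst (_∈ offsets k) (sym (ℤ.[1+m]⊖[1+n]≡m⊖n i i')) (∈-offsets⁺ i i' (ℕ.<⇒≤ i<k) (ℕ.<⇒≤ i'<k))

  ∈-offsets⁻ : ∀ k {o} → o ∈ offsets k → ∃₂ λ i i' → i ≤ k × i' ≤ k × o ≡ i ⊖ i'
  ∈-offsets⁻ k o∈ with ∈-++⁻ (map +_ (upTo (suc k))) o∈
  ... | inj₁ o∈⁺ with ∈-map⁻ +_ o∈⁺
  ...   | i , i∈ , refl = i , 0 , ℕ.≤-pred (∈-upTo⁻ i∈) , z≤n , refl
  ∈-offsets⁻ k o∈ | inj₂ o∈⁻ with ∈-map⁻ -[1+_] o∈⁻
  ... | r , r∈ , refl = 0 , suc r , z≤n , ∈-upTo⁻ r∈ , refl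

  place-difference : ∀ i i' b b' → place (+ i) b - place (+ i') b' ≡ place (i ⊖ i') (b - b')
  place-difference i i' b b' =
    trans (translate-difference base (+ i) (+ i') b b') (cong (λ e → place e (b - b')) (ℤ.[+m]-[+n]≡m⊖n i i'))

  differenceLayers : List ℤ → ℕ → List Layer
  differenceLayers B k = copies (offsets k) (differences B)

  block-differences-⊆ : ∀ B k → diffSet (block B (suc k)) ⊆ layers (differenceLayers B k)
  block-differences-⊆ B k z∈ with ∈-diffSet⁻ (block B (suc k)) z∈
  ... | a , a' , a∈ , a'∈ , refl with ∈-block⁻ B (suc k) a∈ | ∈-block⁻ B (suc k) a'∈
  ...   | i , i<k , b , b∈ , refl | i' , i'<k , b' , b'∈ , refl =
    subst (_∈ layers (differenceLayers B k)) (sym (place-difference i i' b b'))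
      (∈-layers⁺ (differenceLayers B k)
        (∈-map⁺ (_, differences B) (∈-offsets⁺ i i' (ℕ.≤-pred i<k) (ℕ.≤-pred i'<k)))
        (∈-dedup⁺ (∈-diffSet⁺ b∈ b'∈)))

  layers-⊆-block-differences : ∀ B k → layers (differenceLayers B k) ⊆ diffSet (block B (suc k))
  layers-⊆-block-differences B k z∈ with ∈-layers⁻ (differenceLayers B k) z∈
  ... | e , L , p∈ , d , d∈ , refl with ∈-copies⁻ (offsets k) (differences B) p∈
  ...   | e∈ , refl with ∈-offsets⁻ k e∈ | ∈-diffSet⁻ B (∈-dedup⁻ d∈)
  ...     | i , i' , i≤k , i'≤k , refl | b , b' , b∈ , b'∈ , refl =
    subst (_∈ diffSet (block B (suc k))) (place-difference i i' b b')
      (∈-diffSet⁺ (∈-block⁺ B (s≤s i≤k) b∈) (∈-block⁺ B (s≤s i'≤k) b'∈))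

  card-block-differences : ∀ B k → All Digit (differences B) →
    card (diffSet (block B (suc k))) ≡ (suc k ℕ.+ k) ℕ.* length (differences B)
  card-block-differences B k D-digits = begin
    card (diffSet (block B (suc k)))               ≡⟨ card-≡ layers! (block-differences-⊆ B k) (layers-⊆-block-differences B k) ⟩
    length (layers (differenceLayers B k))         ≡⟨ length-copies (offsets k) (differences B) ⟩
    length (offsets k) ℕ.* length (differences B)  ≡⟨ cong (ℕ._* length (differences B)) (length-offsets k) ⟩
    (suc k ℕ.+ k) ℕ.* length (differences B)       ∎
    where
    open ≡-Reasoning
    layers! : Unique (layers (differenceLayers B k))
    layers! = layers-unique (differenceLayers B k)
      (subst Unique (sym (copies-indices (offsets k) (differences B))) (offsets-unique k))
      (copies-proper (offsets k) (deduplicate-! (diffSet B)) D-digits)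

  -- Index sums run over
  -- 0, …, 2j+2.  The extreme sums 0 and 2j+2 arise only from i = i' and carry a copy
  -- of B ∔ B; every inner sum also arises from some i ≠ i' and carries all of B + B.

  data IndexSum (j : ℕ) : ℕ → ℕ → Set where
    bottom : IndexSum j 0 0
    top    : IndexSum j (suc j) (suc j)
    inner  : ∀ {i i'} t → t < suc (j ℕ.+ j) → i ℕ.+ i' ≡ suc t → IndexSum j i i'

  classify : ∀ j {i i'} → i ≤ suc j → i' ≤ suc j → IndexSum j i i'
  classify j {zero}  {zero}   _          _            = bottom
  classify j {zero}  {suc i'} _          (s≤s i'≤j)   = inner i' (s≤s (ℕ.≤-trans i'≤j (ℕ.m≤m+n j j))) refl
  classify j {suc i} {zero}   (s≤s i≤j)  _            =
    inner i (s≤s (ℕ.≤-trans i≤j (ℕ.m≤m+n j j))) (cong suc (ℕ.+-identityʳ i))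
  classify j {suc i} {suc i'} (s≤s i≤j)  (s≤s i'≤j) with ℕ.m≤n⇒m<n∨m≡n i≤j | ℕ.m≤n⇒m<n∨m≡n i'≤j
  ... | inj₂ refl | inj₂ refl = top
  ... | inj₁ i<j  | _         = inner (i ℕ.+ suc i') (s≤s (ℕ.≤-trans (ℕ.≤-reflexive (ℕ.+-suc i i')) (ℕ.+-mono-≤ i<j i'≤j))) refl
  ... | inj₂ refl | inj₁ i'<j = inner (i ℕ.+ suc i') (s≤s (ℕ.+-monoʳ-≤ i i'<j)) refl

  split-inner : ∀ j t → t < suc (j ℕ.+ j) → ∃₂ λ i i' → i ≤ suc j × i' ≤ suc j × i ≢ i' × i ℕ.+ i' ≡ suc t
  split-inner j t t<2j+1 with t ℕ.≤? j
  ... | yes t≤j = suc t , 0 , s≤s t≤j , z≤n , (λ ()) , cong suc (ℕ.+-identityʳ t)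
  ... | no  t≰j = suc j , t ℕ.∸ j , ℕ.≤-refl , ℕ.m≤n⇒m≤1+n t-j≤j ,
                  (λ same → ℕ.<-irrefl (sym same) (s≤s t-j≤j)) , cong suc (ℕ.m+[n∸m]≡n (ℕ.<⇒≤ (ℕ.≰⇒> t≰j)))
    where
    t-j≤j : t ℕ.∸ j ≤ j
    t-j≤j = subst (t ℕ.∸ j ≤_) (ℕ.m+n∸n≡m j j) (ℕ.∸-monoˡ-≤ j (ℕ.≤-pred t<2j+1))

  innerIndices : ℕ → List ℤ
  innerIndices j = map (+_ ∘ suc) (upTo (suc (j ℕ.+ j)))

  topIndex : ℕ → ℤ
  topIndex j = + (suc j ℕ.+ suc j)

  restrictedSumLayers : List ℤ → ℕ → List Layer
  restrictedSumLayers B j =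
    (+ 0 , restrictedSums B) ∷ (topIndex j , restrictedSums B) ∷ copies (innerIndices j) (sums B)

  restrictedSumIndices-unique : ∀ j → Unique (+ 0 ∷ topIndex j ∷ innerIndices j)
  restrictedSumIndices-unique j =
    All.tabulate bottom-new ∷ All.tabulate top-new ∷ Unique.map⁺ (ℕ.suc-injective ∘ ℤ.+-injective) (Unique.upTo⁺ _)
    where
    top-new : ∀ {e} → e ∈ innerIndices j → topIndex j ≢ e
    top-new e∈ same with ∈-map⁻ (+_ ∘ suc) e∈
    ... | t , t∈ , refl =
      ℕ.<-irrefl (trans (sym (ℕ.suc-injective (ℤ.+-injective same))) (ℕ.+-suc j j)) (∈-upTo⁻ t∈)
    bottom-new : ∀ {e} → e ∈ topIndex j ∷ innerIndices j → + 0 ≢ e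
    bottom-new (here refl) ()
    bottom-new (there e∈) same with ∈-map⁻ (+_ ∘ suc) e∈
    bottom-new (there e∈) () | t , t∈ , refl

  restricted-sum-layer : ∀ B j {i i' b b'} → IndexSum j i i' → b ∈ B → b' ∈ B →
    place (+ i) b ≢ place (+ i') b' → place (+ i + + i') (b + b') ∈ layers (restrictedSumLayers B j)
  restricted-sum-layer B j bottom b∈ b'∈ a≢a' =
    ∈-layers⁺ (restrictedSumLayers B j) (here refl)
      (∈-dedup⁺ (∈-restrSumSet⁺ b∈ b'∈ (a≢a' ∘ cong (place (+ 0)))))
  restricted-sum-layer B j top b∈ b'∈ a≢a' =
    ∈-layers⁺ (restrictedSumLayers B j) (there (here refl))
      (∈-dedup⁺ (∈-restrSumSet⁺ b∈ b'∈ (a≢a' ∘ cong (place (+ suc j)))))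
  restricted-sum-layer B j {b = b} {b'} (inner t t<2j+1 i+i'≡) b∈ b'∈ _ =
    subst (λ s → place (+ s) (b + b') ∈ layers (restrictedSumLayers B j)) (sym i+i'≡)
      (∈-layers⁺ (restrictedSumLayers B j)
        (there (there (∈-map⁺ (_, sums B) (∈-map⁺ (+_ ∘ suc) (∈-upTo⁺ t<2j+1)))))
        (∈-dedup⁺ (∈-sumSet⁺ b∈ b'∈)))

  block-restrictedSums-⊆ : ∀ B j → restrSumSet (block B (2 ℕ.+ j)) ⊆ layers (restrictedSumLayers B j)
  block-restrictedSums-⊆ B j z∈ with ∈-restrSumSet⁻ (block B (2 ℕ.+ j)) z∈
  ... | a , a' , a∈ , a'∈ , a≢a' , refl with ∈-block⁻ B (2 ℕ.+ j) a∈ | ∈-block⁻ B (2 ℕ.+ j) a'∈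
  ...   | i , i<k , b , b∈ , refl | i' , i'<k , b' , b'∈ , refl =
    subst (_∈ layers (restrictedSumLayers B j)) (sym (translate-sum base (+ i) (+ i') b b'))
      (restricted-sum-layer B j (classify j (ℕ.≤-pred i<k) (ℕ.≤-pred i'<k)) b∈ b'∈ a≢a')

  -- B ∔ B placed at the doubled index 2i comes from two distinct elements of copy i
  doubled-index : ∀ B {k i d} → i < k → d ∈ restrictedSums B → place (+ i + + i) d ∈ restrSumSet (block B k)
  doubled-index B {k} {i} i<k d∈ with ∈-restrSumSet⁻ B (∈-dedup⁻ d∈)
  ... | b , b' , b∈ , b'∈ , b≢b' , refl =
    subst (_∈ restrSumSet (block B k)) (translate-sum base (+ i) (+ i) b b')
      (∈-restrSumSet⁺ (∈-block⁺ B i<k b∈) (∈-block⁺ B i<k b'∈) (b≢b' ∘ ∙-cancelˡ (base * + i) b b'))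

  -- B + B placed at an inner index comes from elements of two different copies
  inner-index : ∀ B j → All Digit B → ∀ {t d} → t < suc (j ℕ.+ j) → d ∈ sums B →
    place (+ suc t) d ∈ restrSumSet (block B (2 ℕ.+ j))
  inner-index B j B-digits {t} t<2j+1 d∈ with split-inner j t t<2j+1 | ∈-sumSet⁻ B (∈-dedup⁻ d∈)
  ... | i , i' , i≤ , i'≤ , i≢i' , i+i'≡ | b , b' , b∈ , b'∈ , refl =
    subst (λ s → place (+ s) (b + b') ∈ restrSumSet (block B (2 ℕ.+ j))) i+i'≡
      (subst (_∈ restrSumSet (block B (2 ℕ.+ j))) (translate-sum base (+ i) (+ i') b b')
        (∈-restrSumSet⁺ (∈-block⁺ B (s≤s i≤) b∈) (∈-block⁺ B (s≤s i'≤) b'∈)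
          (i≢i' ∘ ℤ.+-injective ∘ expansion-unique (All.lookup B-digits b∈) (All.lookup B-digits b'∈))))

  layers-⊆-block-restrictedSums : ∀ B j → All Digit B →
    layers (restrictedSumLayers B j) ⊆ restrSumSet (block B (2 ℕ.+ j))
  layers-⊆-block-restrictedSums B j B-digits z∈ with ∈-layers⁻ (restrictedSumLayers B j) z∈
  ... | _ , _ , here refl , d , d∈ , refl         = doubled-index B {2 ℕ.+ j} (s≤s z≤n) d∈
  ... | _ , _ , there (here refl) , d , d∈ , refl = doubled-index B {2 ℕ.+ j} (ℕ.n<1+n (suc j)) d∈
  ... | e , L , there (there p∈) , d , d∈ , refl with ∈-copies⁻ (innerIndices j) (sums B) p∈
  ...   | e∈ , refl with ∈-map⁻ (+_ ∘ suc) e∈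
  ...     | t , t∈ , refl = inner-index B j B-digits (∈-upTo⁻ t∈) d∈

  card-block-restrictedSums : ∀ B j → All Digit B → All Digit (sums B) → All Digit (restrictedSums B) →
    card (restrSumSet (block B (2 ℕ.+ j)))
      ≡ length (restrictedSums B) ℕ.+ (length (restrictedSums B) ℕ.+ suc (j ℕ.+ j) ℕ.* length (sums B))
  card-block-restrictedSums B j B-digits S-digits R-digits = begin
    card (restrSumSet (block B (2 ℕ.+ j)))          ≡⟨ card-≡ layers! (block-restrictedSums-⊆ B j) (layers-⊆-block-restrictedSums B j B-digits) ⟩
    length (layers (restrictedSumLayers B j))      ≡⟨ length-layers-∷ (+ 0) R (topLayer ∷ innerLayers) ⟩
    ∣R∣ ℕ.+ length (layers (topLayer ∷ innerLayers)) ≡⟨ cong (∣R∣ ℕ.+_) (length-layers-∷ (topIndex j) R innerLayers) ⟩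
    ∣R∣ ℕ.+ (∣R∣ ℕ.+ length (layers innerLayers))    ≡⟨ cong (λ n → ∣R∣ ℕ.+ (∣R∣ ℕ.+ n)) (length-copies (innerIndices j) S) ⟩
    ∣R∣ ℕ.+ (∣R∣ ℕ.+ length (innerIndices j) ℕ.* ∣S∣) ≡⟨ cong (λ n → ∣R∣ ℕ.+ (∣R∣ ℕ.+ n ℕ.* ∣S∣)) inner-count ⟩
    ∣R∣ ℕ.+ (∣R∣ ℕ.+ suc (j ℕ.+ j) ℕ.* ∣S∣)          ∎
    where
    open ≡-Reasoning
    R = restrictedSums B
    S = sums B
    ∣R∣ = length R
    ∣S∣ = length S
    topLayer : Layer
    topLayer = topIndex j , R
    innerLayers : List Layer
    innerLayers = copies (innerIndices j) S
    inner-count : length (innerIndices j) ≡ suc (j ℕ.+ j)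
    inner-count = trans (List.length-map (+_ ∘ suc) (upTo (suc (j ℕ.+ j)))) (List.length-upTo (suc (j ℕ.+ j)))
    layers! : Unique (layers (restrictedSumLayers B j))
    layers! = layers-unique (restrictedSumLayers B j)
      (subst (λ es → Unique (+ 0 ∷ topIndex j ∷ es)) (sym (copies-indices (innerIndices j) S))
        (restrictedSumIndices-unique j))
      ((deduplicate-! _ , R-digits) All.∷ (deduplicate-! _ , R-digits) All.∷
        copies-proper (innerIndices j) (deduplicate-! _) S-digits)

  -- |A - A| and |A ∔ A| for A = block B (2 + j), as counted by layers:
  -- (2j + 3) copies of B - B, resp. two copies of B ∔ B and (2j + 1) of B + B
  differenceCount restrictedSumCount : List ℤ → ℕ → ℕ
  differenceCount B j = (2 ℕ.+ j ℕ.+ suc j) ℕ.* length (differences B)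
  restrictedSumCount B j = length (restrictedSums B) ℕ.+ (length (restrictedSums B) ℕ.+ suc (j ℕ.+ j) ℕ.* length (sums B))

  Δ-block : ∀ B → All Digit B → All Digit (differences B) → All Digit (sums B) → All Digit (restrictedSums B) →
    ∀ j → Δ (block B (2 ℕ.+ j)) ≡ differenceCount B j ⊖ restrictedSumCount B j
  Δ-block B B-digits D-digits S-digits R-digits j =
    cong₂ _⊖_ (card-block-differences B (suc j) D-digits) (card-block-restrictedSums B j B-digits S-digits R-digits)

  -- the digit conditions are decidable, so for concrete B they are checked by evaluation
  digits? : (xs : List ℤ) → Dec (All Digit xs)
  digits? = All.all? (λ d → ∣ d ∣ ℕ.<? w)

  progression : ∀ B {B✓ : True (digits? B)} {D✓ : True (digits? (differences B))}
    {S✓ : True (digits? (sums B))} {R✓ : True (digits? (restrictedSums B))} →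
    (a b : ℕ → ℕ) → (∀ j → block B (2 ℕ.+ j) ≢ []) →
    (∀ j → differenceCount B j ℕ.+ b j ≡ restrictedSumCount B j ℕ.+ a j) →
    ∀ j c d → a j ℕ.+ d ≡ b j ℕ.+ c → Realisable (c ⊖ d)
  progression B {B✓} {D✓} {S✓} {R✓} a b nonempty counts j c d same =
    block B (2 ℕ.+ j) , nonempty j ,
      (begin
        Δ (block B (2 ℕ.+ j))                          ≡⟨ Δ-block B (toWitness B✓) (toWitness D✓) (toWitness S✓) (toWitness R✓) j ⟩
        differenceCount B j ⊖ restrictedSumCount B j  ≡⟨ ⊖-cross (a j) (b j) (counts j) ⟩
        a j ⊖ b j                                     ≡⟨ ⊖-cross c d same ⟩
        c ⊖ d                                         ∎)
    where open ≡-Reasoning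

-- Six base sets.  All their elements, differences and sums lie in (-50, 50), so
-- blocks with base 100 follow the layer formula; each yields an arithmetic
-- progression of values of Δ.

open Layering 50

B₁ B₂ B₃ B₄ B₅ B₆ : List ℤ
B₁ = + 0 ∷ + 2 ∷ + 3 ∷ + 4 ∷ + 7 ∷ + 11 ∷ + 12 ∷ + 14 ∷ []
B₂ = + 0 ∷ + 1 ∷ + 2 ∷ + 4 ∷ + 5 ∷ + 9 ∷ + 12 ∷ + 13 ∷ + 14 ∷ + 16 ∷ + 17 ∷ []
B₃ = + 0 ∷ + 1 ∷ + 2 ∷ + 4 ∷ + 6 ∷ + 7 ∷ + 11 ∷ + 13 ∷ + 16 ∷ + 17 ∷ + 18 ∷ []
B₄ = + 0 ∷ + 1 ∷ + 3 ∷ []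
B₅ = + 0 ∷ + 1 ∷ + 2 ∷ + 3 ∷ + 6 ∷ []
B₆ = + 0 ∷ + 1 ∷ + 2 ∷ + 5 ∷ []

-- |B₁ - B₁| = 25, |B₁ ∔ B₁| = 21, |B₁ + B₁| = 26:  Δ = 7 - 2j
family₁ : ∀ j c d → 7 ℕ.+ d ≡ 2 ℕ.* j ℕ.+ c → Realisable (c ⊖ d)
family₁ = progression B₁ (λ _ → 7) (2 ℕ.*_) (λ _ ()) counts
  where
  counts : ∀ j → (2 ℕ.+ j ℕ.+ suc j) ℕ.* 25 ℕ.+ 2 ℕ.* j ≡ 21 ℕ.+ (21 ℕ.+ suc (j ℕ.+ j) ℕ.* 26) ℕ.+ 7
  counts = ℕ-Solver.solve-∀

-- |B₂ - B₂| = 33, |B₂ ∔ B₂| = 30, |B₂ + B₂| = 35:  Δ = 4 - 4j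
family₂ : ∀ j c d → 4 ℕ.+ d ≡ 4 ℕ.* j ℕ.+ c → Realisable (c ⊖ d)
family₂ = progression B₂ (λ _ → 4) (4 ℕ.*_) (λ _ ()) counts
  where
  counts : ∀ j → (2 ℕ.+ j ℕ.+ suc j) ℕ.* 33 ℕ.+ 4 ℕ.* j ≡ 30 ℕ.+ (30 ℕ.+ suc (j ℕ.+ j) ℕ.* 35) ℕ.+ 4
  counts = ℕ-Solver.solve-∀

-- |B₃ - B₃| = 35, |B₃ ∔ B₃| = 33, |B₃ + B₃| = 37:  Δ = 2 - 4j
family₃ : ∀ j c d → 2 ℕ.+ d ≡ 4 ℕ.* j ℕ.+ c → Realisable (c ⊖ d)
family₃ = progression B₃ (λ _ → 2) (4 ℕ.*_) (λ _ ()) counts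
  where
  counts : ∀ j → (2 ℕ.+ j ℕ.+ suc j) ℕ.* 35 ℕ.+ 4 ℕ.* j ≡ 33 ℕ.+ (33 ℕ.+ suc (j ℕ.+ j) ℕ.* 37) ℕ.+ 2
  counts = ℕ-Solver.solve-∀

-- |B₄ - B₄| = 7, |B₄ ∔ B₄| = 3, |B₄ + B₄| = 6:  Δ = 9 + 2j
family₄ : ∀ j c d → (9 ℕ.+ 2 ℕ.* j) ℕ.+ d ≡ 0 ℕ.+ c → Realisable (c ⊖ d)
family₄ = progression B₄ (λ j → 9 ℕ.+ 2 ℕ.* j) (λ _ → 0) (λ _ ()) counts
  where
  counts : ∀ j → (2 ℕ.+ j ℕ.+ suc j) ℕ.* 7 ℕ.+ 0 ≡ 3 ℕ.+ (3 ℕ.+ suc (j ℕ.+ j) ℕ.* 6) ℕ.+ (9 ℕ.+ 2 ℕ.* j)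
  counts = ℕ-Solver.solve-∀

-- |B₅ - B₅| = 13, |B₅ ∔ B₅| = 9, |B₅ + B₅| = 11:  Δ = 10 + 4j
family₅ : ∀ j c d → (10 ℕ.+ 4 ℕ.* j) ℕ.+ d ≡ 0 ℕ.+ c → Realisable (c ⊖ d)
family₅ = progression B₅ (λ j → 10 ℕ.+ 4 ℕ.* j) (λ _ → 0) (λ _ ()) counts
  where
  counts : ∀ j → (2 ℕ.+ j ℕ.+ suc j) ℕ.* 13 ℕ.+ 0 ≡ 9 ℕ.+ (9 ℕ.+ suc (j ℕ.+ j) ℕ.* 11) ℕ.+ (10 ℕ.+ 4 ℕ.* j)
  counts = ℕ-Solver.solve-∀

-- |B₆ - B₆| = 11, |B₆ ∔ B₆| = 6, |B₆ + B₆| = 9:  Δ = 12 + 4j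
family₆ : ∀ j c d → (12 ℕ.+ 4 ℕ.* j) ℕ.+ d ≡ 0 ℕ.+ c → Realisable (c ⊖ d)
family₆ = progression B₆ (λ j → 12 ℕ.+ 4 ℕ.* j) (λ _ → 0) (λ _ ()) counts
  where
  counts : ∀ j → (2 ℕ.+ j ℕ.+ suc j) ℕ.* 11 ℕ.+ 0 ≡ 6 ℕ.+ (6 ℕ.+ suc (j ℕ.+ j) ℕ.* 9) ℕ.+ (12 ℕ.+ 4 ℕ.* j)
  counts = ℕ-Solver.solve-∀

-- two sporadic sets fill the gaps 6 and 8 of the progressions
S₆ S₈ : List ℤ
S₆ = + 0 ∷ + 1 ∷ + 2 ∷ + 3 ∷ + 7 ∷ []
S₈ = + 0 ∷ + 1 ∷ + 3 ∷ + 7 ∷ + 8 ∷ []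

positive : ∀ q r → r < 4 → Realisable (+ (r ℕ.+ q ℕ.* 4))
positive 0                   0 _ = family₂ 1 0 0 refl
positive 1                   0 _ = family₂ 0 4 0 refl
positive 2                   0 _ = S₈ , (λ ()) , refl
positive (suc (suc (suc q))) 0 _ = family₆ q (suc (suc (suc q)) ℕ.* 4) 0 (ℕ-Solver.solve (q ∷ []))
positive 0                   1 _ = family₁ 3 1 0 refl
positive 1                   1 _ = family₁ 1 5 0 refl
positive (suc (suc q))       1 _ = family₄ (2 ℕ.* q) (1 ℕ.+ suc (suc q) ℕ.* 4) 0 (ℕ-Solver.solve (q ∷ []))
positive 0                   2 _ = family₃ 0 2 0 refl
positive 1                   2 _ = S₆ , (λ ()) , refl
positive (suc (suc q))       2 _ = family₅ q (2 ℕ.+ suc (suc q) ℕ.* 4) 0 (ℕ-Solver.solve (q ∷ []))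
positive 0                   3 _ = family₁ 2 3 0 refl
positive 1                   3 _ = family₁ 0 7 0 refl
positive (suc (suc q))       3 _ = family₄ (1 ℕ.+ 2 ℕ.* q) (3 ℕ.+ suc (suc q) ℕ.* 4) 0 (ℕ-Solver.solve (q ∷ []))
positive q (suc (suc (suc (suc r)))) (s≤s (s≤s (s≤s (s≤s ()))))

negative : ∀ q r → r < 4 → Realisable -[1+ (r ℕ.+ q ℕ.* 4) ]
negative q 0 _ = family₁ (4 ℕ.+ 2 ℕ.* q) 0 (suc (0 ℕ.+ q ℕ.* 4)) (ℕ-Solver.solve (q ∷ []))
negative q 1 _ = family₃ (1 ℕ.+ q) 0 (suc (1 ℕ.+ q ℕ.* 4)) (ℕ-Solver.solve (q ∷ []))
negative q 2 _ = family₁ (5 ℕ.+ 2 ℕ.* q) 0 (suc (2 ℕ.+ q ℕ.* 4)) (ℕ-Solver.solve (q ∷ []))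
negative q 3 _ = family₂ (2 ℕ.+ q) 0 (suc (3 ℕ.+ q ℕ.* 4)) (ℕ-Solver.solve (q ∷ []))
negative q (suc (suc (suc (suc r)))) (s≤s (s≤s (s≤s (s≤s ()))))

realisable : ∀ t → Realisable t
realisable (+ n)     = subst (Realisable ∘ +_) (sym (m≡m%n+[m/n]*n n 4)) (positive (n / 4) (n % 4) (m%n<n n 4))
realisable -[1+ n ]  = subst (Realisable ∘ -[1+_]) (sym (m≡m%n+[m/n]*n n 4)) (negative (n / 4) (n % 4) (m%n<n n 4))

theorem2 : (x : ℤ) → Σ (List ℤ) (λ A → (A ≢ []) × (Δ A ≡ - x))
theorem2 x = realisable (- x)
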